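{- The relation $\mid\hspace{ -2.4pt}\sim_{lRJ}$ satisfies the following rules, for all finite multisets $\Delta$ of formulas of $\mathrm{Fm}_{\mathcal D}$, $\gamma,\delta\in\mathrm{Fm}_{\mathcal D}$ and $\varphi,\psi\in\mathrm{Fm}_{\mathcal H}$: (RWE) if $\Delta\mid\hspace{ -2.4pt}\sim_{lRJ}\varphi$ and $\varphi\models\psi$ then $\Delta\mid\hspace{ -2.4pt}\sim_{lRJ}\psi$; (LLE) if $\Delta,\gamma\mid\hspace{ -2.4pt}\sim_{lRJ}\varphi$ and $\models\gamma\leftrightarrow\delta$ then $\Delta,\delta\mid\hspace{ -2.4pt}\sim_{lRJ}\varphi$; (AND) if $\Delta\mid\hspace{ -2.4pt}\sim_{lRJ}\varphi$ and $\Delta\mid\hspace{ -2.4pt}\sim_{lRJ}\psi$ then $\Delta\mid\hspace{ -2.4pt}\sim_{lRJ}\varphi\wedge\psi$; $(\text{AND})_l$ if $\Delta,\delta,\gamma\mid\hspace{ -2.4pt}\sim_{lRJ}\varphi$ and $\neg\gamma,\neg\delta\models\bot$ then $\Delta,\delta\wedge\gamma\mid\hspace{ -2.4pt}\sim_{lRJ}\varphi$; $(\text{AND})_l^{con}$ if $\Delta,\delta\wedge\gamma\mid\hspace{ -2.4pt}\sim_{lRJ}\varphi$ and $\neg\gamma,\neg\delta\models\bot$ then $\Delta,\delta,\gamma\mid\hspace{ -2.4pt}\sim_{lRJ}\varphi$.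
   Context: $\mathcal H=\{H_1,\dots,H_n\}$ and $\mathcal D=\{d_1,\dots,d_l\}$ are finite sets of propositional variables (not necessarily disjoint); $\mathrm{Fm}_{\mathcal H}$, $\mathrm{Fm}_{\mathcal D}$ are the classical propositional formulas over them built with $\wedge,\vee,\neg$, and $\mathrm{Fm}$ the formulas over $\mathcal H\cup\mathcal D$; $\models$ is classical consequence, $\bot$ a contradiction. $T:=\bigvee_{H\in\mathcal H}H\wedge\bigwedge_{H\neq H'}(H\rightarrow\neg H')$. Fix a probability function $P$ on $\mathrm{Fm}$ (normalized on tautologies and finitely additive on incompatible formulas) with $P(H)>0$ for every $H\in\mathcal H$, and $P(\delta\mid H)=P(\delta\wedge H)/P(H)$. For a finite multiset $\Delta$ of formulas of $\mathrm{Fm}_{\mathcal D}$ let $r^l_\Delta(H)=\sum_{\delta\in\Delta}P(\neg\delta\mid H)$ (over occurrences), and $\hat{\mathcal H}_\Delta$ the set of $H\in\mathcal H$ minimizing $r^l_\Delta(H)$. Then $\Delta\mid\hspace{ -2.4pt}\sim_{lRJ}\varphi$ iff $T,H\models\varphi$ for every $H\in\hat{\mathcal H}_\Delta$. "$\Delta,\gamma$" denotes $\Delta$ with one more occurrence of $\gamma$. -}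

module Defs where

open import Level using (Level; _⊔_) renaming (suc to lsuc)
open import Data.Nat using (ℕ)
open import Data.Bool using (Bool; true; false; _∧_; _∨_; not; T)
open import Data.List using (List; []; _∷_; _++_; foldr; map; _∷ʳ_)
open import Data.List.Membership.Propositional using (_∈_)
open import Data.List.Relation.Unary.All using (All)
open import Data.Product using (Σ; _×_; ∃; _,_)
open import Relation.Nullary using (¬_)
open import Relation.Binary.PropositionalEquality using (_≡_)
open import Relation.Binary.Structures using (IsTotalOrder)
open import Algebra.Bundles using (CommutativeRing)

-- Ordered fields (the value domain of probabilities; ℝ is an instance)

record OrderedField (c ℓ₁ ℓ₂ : Level) : Set (lsuc (c ⊔ ℓ₁ ⊔ ℓ₂)) where
  field
    commutativeRing : CommutativeRing c ℓ₁
  open CommutativeRing commutativeRing public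
  field
    _⁻¹      : Carrier → Carrier
    ⁻¹-cong  : ∀ {x y} → x ≈ y → x ⁻¹ ≈ y ⁻¹
    inverseʳ : ∀ x → ¬ (x ≈ 0#) → x * (x ⁻¹) ≈ 1#
    1≉0      : ¬ (1# ≈ 0#)
    _≤_           : Carrier → Carrier → Set ℓ₂
    isTotalOrder  : IsTotalOrder _≈_ _≤_
    +-monoˡ-≤     : ∀ {x y} z → x ≤ y → (x + z) ≤ (y + z)
    *-nonneg      : ∀ {x y} → 0# ≤ x → 0# ≤ y → 0# ≤ (x * y)

  _<_ : Carrier → Carrier → Set (ℓ₁ ⊔ ℓ₂)
  x < y = (x ≤ y) × ¬ (x ≈ y)

  _÷_ : Carrier → Carrier → Carrier
  x ÷ y = x * (y ⁻¹)

data Form : Set where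
  var  : ℕ → Form
  _∧̇_  : Form → Form → Form
  _∨̇_  : Form → Form → Form
  ¬̇_   : Form → Form

infixr 6 _∧̇_
infixr 5 _∨̇_
infix  7 ¬̇_

data Over (S : List ℕ) : Form → Set where
  var : ∀ {x} → x ∈ S → Over S (var x)
  and : ∀ {φ ψ} → Over S φ → Over S ψ → Over S (φ ∧̇ ψ)
  or  : ∀ {φ ψ} → Over S φ → Over S ψ → Over S (φ ∨̇ ψ)
  neg : ∀ {φ} → Over S φ → Over S (¬̇ φ)

Valuation : Set
Valuation = ℕ → Bool

⟦_⟧ : Form → Valuation → Bool
⟦ var x ⟧ v = v x
⟦ φ ∧̇ ψ ⟧ v = ⟦ φ ⟧ v ∧ ⟦ ψ ⟧ v
⟦ φ ∨̇ ψ ⟧ v = ⟦ φ ⟧ v ∨ ⟦ ψ ⟧ v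
⟦ ¬̇ φ ⟧ v = not (⟦ φ ⟧ v)

_↔̇_ : Form → Form → Form
φ ↔̇ ψ = (¬̇ φ ∨̇ ψ) ∧̇ (¬̇ ψ ∨̇ φ)

_⊨_ : List Form → Form → Set
Γ ⊨ φ = ∀ (v : Valuation) → All (λ γ → T (⟦ γ ⟧ v)) Γ → T (⟦ φ ⟧ v)

_⊨⊥ : List Form → Set
Γ ⊨⊥ = ∀ (v : Valuation) → ¬ All (λ γ → T (⟦ γ ⟧ v)) Γ

Valid : Form → Set
Valid φ = [] ⊨ φ

module Setup {c ℓ₁ ℓ₂ : Level} (𝔽 : OrderedField c ℓ₁ ℓ₂)
             (𝓗 𝓓 : List ℕ) where
  open OrderedField 𝔽

  FmH FmD Fm : Form → Set
  FmH = Over 𝓗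
  FmD = Over 𝓓
  Fm  = Over (𝓗 ++ 𝓓)

  SatT : Valuation → Set
  SatT v = (∃ λ H → H ∈ 𝓗 × T (v H))
         × (∀ H H' → H ∈ 𝓗 → H' ∈ 𝓗 → ¬ (H ≡ H') → T (v H) → T (not (v H')))

  T,_⊨_ : ℕ → Form → Set
  T, H ⊨ φ = ∀ (v : Valuation) → SatT v → T (v H) → T (⟦ φ ⟧ v)

  record IsProbability (P : Form → Carrier) : Set (c ⊔ ℓ₁ ⊔ ℓ₂) where
    field
      nonneg     : ∀ φ → Fm φ → 0# ≤ P φ
      normalized : ∀ φ → Fm φ → Valid φ → P φ ≈ 1#
      additive   : ∀ φ ψ → Fm φ → Fm ψ → Valid (¬̇ (φ ∧̇ ψ)) →
                   P (φ ∨̇ ψ) ≈ P φ + P ψ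

  module lRJ (P : Form → Carrier) where

    Pc : Form → ℕ → Carrier
    Pc δ H = P (δ ∧̇ var H) ÷ P (var H)

    -- r^l_Δ(H) = Σ_{δ∈Δ} P(¬δ | H), summed over occurrences
    r : List Form → ℕ → Carrier
    r Δ H = foldr _+_ 0# (map (λ δ → Pc (¬̇ δ) H) Δ)

    Ĥ : List Form → ℕ → Set ℓ₂
    Ĥ Δ H = H ∈ 𝓗 × (∀ H' → H' ∈ 𝓗 → r Δ H ≤ r Δ H')

    _|~_ : List Form → Form → Set ℓ₂
    Δ |~ φ = ∀ H → Ĥ Δ H → T, H ⊨ φ

-- The minimisers Ĥ_Δ depend on Δ only through the function H ↦ r_Δ(H), and r_Δ(H) is a
-- sum over the occurrences in Δ.  (RWE) and (AND) concern only the conclusion side, where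
-- T, H ⊨ _ is closed under consequence and conjunction.  For (LLE) the summands P(¬γ | H)
-- and P(¬δ | H) coincide because ¬γ ∧ H and ¬δ ∧ H are equivalent.  For (AND)_l and its
-- converse, ¬γ, ¬δ ⊨ ⊥ makes ¬δ ∧ H and ¬γ ∧ H incompatible, so finite additivity gives
-- P(¬(δ ∧ γ) | H) = P(¬δ | H) + P(¬γ | H): the two multisets have the same r, hence the
-- same minimisers.
module Submission where

open import Defs
open import Level using (Level)
open import Data.Nat using (ℕ)
open import Data.Bool using (true; false; _∧_; not; T)
open import Data.Bool.Properties using (∧-distribʳ-∨; ∨-inverseʳ; ∧-inverseʳ; T-≡; T-not-≡; T-∧)
open import Data.List using (List; []; _∷_; _∷ʳ_)
open import Data.List.Membership.Propositional using (_∈_)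
open import Data.List.Membership.Propositional.Properties using (∈-++⁺ˡ; ∈-++⁺ʳ)
open import Data.List.Relation.Unary.All using (All; []; _∷_)
open import Data.Product using (_×_; _,_)
open import Data.Unit using (tt)
open import Data.Empty using (⊥; ⊥-elim)
open import Function.Bundles using (Equivalence)
open import Relation.Binary.PropositionalEquality using (_≡_; refl; cong)
open import Relation.Binary.Structures using (IsTotalOrder)
import Algebra.Properties.Group as GroupProperties
import Relation.Binary.Reasoning.Setoid as SetoidReasoning

Over-mono : ∀ {S S′} → (∀ {x} → x ∈ S → x ∈ S′) → ∀ {φ} → Over S φ → Over S′ φ
Over-mono S⊆S′ (var x∈S) = var (S⊆S′ x∈S)
Over-mono S⊆S′ (and p q) = and (Over-mono S⊆S′ p) (Over-mono S⊆S′ q)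
Over-mono S⊆S′ (or p q)  = or (Over-mono S⊆S′ p) (Over-mono S⊆S′ q)
Over-mono S⊆S′ (neg p)   = neg (Over-mono S⊆S′ p)

infix 4 _≋_

_≋_ : Form → Form → Set
φ ≋ ψ = ∀ v → ⟦ φ ⟧ v ≡ ⟦ ψ ⟧ v

≋-refl : ∀ {φ} → φ ≋ φ
≋-refl _ = refl

Valid-↔⇒≋ : ∀ {φ ψ} → Valid (φ ↔̇ ψ) → φ ≋ ψ
Valid-↔⇒≋ {φ} {ψ} φ↔ψ v with ⟦ φ ⟧ v | ⟦ ψ ⟧ v | φ↔ψ v []
... | true  | true  | _  = refl
... | false | false | _  = refl
... | true  | false | ()
... | false | true  | ()

¬̇-deMorgan : ∀ φ ψ → ¬̇ (φ ∧̇ ψ) ≋ ¬̇ φ ∨̇ ¬̇ ψ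
¬̇-deMorgan φ ψ v with ⟦ φ ⟧ v
... | true  = refl
... | false = refl

∧̇-distribʳ-∨̇ : ∀ φ ψ χ → (φ ∨̇ ψ) ∧̇ χ ≋ (φ ∧̇ χ) ∨̇ (ψ ∧̇ χ)
∧̇-distribʳ-∨̇ φ ψ χ v = ∧-distribʳ-∨ (⟦ χ ⟧ v) (⟦ φ ⟧ v) (⟦ ψ ⟧ v)

⊨⊥⇒Valid-¬∧ : ∀ {φ ψ} → (φ ∷ ψ ∷ []) ⊨⊥ → Valid (¬̇ (ψ ∧̇ φ))
⊨⊥⇒Valid-¬∧ {φ} {ψ} φ,ψ⊨⊥ v _ =
  T-not-∧ (⟦ ψ ⟧ v) (⟦ φ ⟧ v) (λ ψ-holds φ-holds → φ,ψ⊨⊥ v (φ-holds ∷ ψ-holds ∷ []))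
  where
  T-not-∧ : ∀ a b → (T a → T b → ⊥) → T (not (a ∧ b))
  T-not-∧ false _     _ = tt
  T-not-∧ true  false _ = tt
  T-not-∧ true  true  k = ⊥-elim (k tt tt)

Valid-¬∧-∧̇ʳ : ∀ {φ ψ} χ → Valid (¬̇ (φ ∧̇ ψ)) → Valid (¬̇ ((φ ∧̇ χ) ∧̇ (ψ ∧̇ χ)))
Valid-¬∧-∧̇ʳ {φ} {ψ} χ incompatible v _ with ⟦ φ ⟧ v | ⟦ ψ ⟧ v | ⟦ χ ⟧ v | incompatible v []
... | false | _     | _     | _  = tt
... | true  | false | true  | _  = tt
... | true  | false | false | _  = tt
... | true  | true  | false | _  = tt
... | true  | true  | true  | ()

module Inference {c ℓ₁ ℓ₂ : Level} (𝔽 : OrderedField c ℓ₁ ℓ₂) (𝓗 𝓓 : List ℕ)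
    (P : Form → OrderedField.Carrier 𝔽) where
  open OrderedField 𝔽
  open Setup 𝔽 𝓗 𝓓
  open lRJ P
  open IsTotalOrder isTotalOrder using () renaming (reflexive to ≤-reflexive; trans to ≤-trans)
  open SetoidReasoning setoid

  RWE : ∀ Δ φ ψ → Δ |~ φ → (φ ∷ []) ⊨ ψ → Δ |~ ψ
  RWE Δ φ ψ Δ|~φ φ⊨ψ H Ĥ∋H v T-sat H-holds = φ⊨ψ v (Δ|~φ H Ĥ∋H v T-sat H-holds ∷ [])

  AND : ∀ Δ φ ψ → Δ |~ φ → Δ |~ ψ → Δ |~ (φ ∧̇ ψ)
  AND Δ φ ψ Δ|~φ Δ|~ψ H Ĥ∋H v T-sat H-holds =
    Equivalence.from T-∧ (Δ|~φ H Ĥ∋H v T-sat H-holds , Δ|~ψ H Ĥ∋H v T-sat H-holds)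

  |~-resp-r : ∀ Δ Δ′ φ → (∀ H → H ∈ 𝓗 → r Δ H ≈ r Δ′ H) → Δ |~ φ → Δ′ |~ φ
  |~-resp-r Δ Δ′ φ r≈ Δ|~φ H (H∈𝓗 , minimal) = Δ|~φ H (H∈𝓗 , minimal-for-Δ)
    where
    minimal-for-Δ : ∀ H′ → H′ ∈ 𝓗 → r Δ H ≤ r Δ H′
    minimal-for-Δ H′ H′∈𝓗 =
      ≤-trans (≤-reflexive (r≈ H H∈𝓗)) (≤-trans (minimal H′ H′∈𝓗) (≤-reflexive (sym (r≈ H′ H′∈𝓗))))

  r-∷ʳ : ∀ Δ δ H → r (Δ ∷ʳ δ) H ≈ r Δ H + Pc (¬̇ δ) H
  r-∷ʳ []      δ H = trans (+-identityʳ _) (sym (+-identityˡ _))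
  r-∷ʳ (γ ∷ Δ) δ H = trans (+-congˡ (r-∷ʳ Δ δ H)) (sym (+-assoc _ _ _))

  FmD⇒Fm : ∀ {φ} → FmD φ → Fm φ
  FmD⇒Fm = Over-mono (∈-++⁺ʳ 𝓗)

  Fm-var : ∀ {H} → H ∈ 𝓗 → Fm (var H)
  Fm-var H∈𝓗 = var (∈-++⁺ˡ H∈𝓗)

  module _ (isProbability : IsProbability P) where
    open IsProbability isProbability
    open GroupProperties +-group using () renaming (∙-cancelʳ to +-cancelʳ)

    P-complement : ∀ {φ ψ} → Fm φ → Fm ψ → φ ≋ ψ → P φ + P (¬̇ ψ) ≈ 1#
    P-complement {φ} {ψ} fφ fψ φ≋ψ = begin
      P φ + P (¬̇ ψ)  ≈⟨ additive φ (¬̇ ψ) fφ (neg fψ) disjoint ⟨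
      P (φ ∨̇ ¬̇ ψ)   ≈⟨ normalized (φ ∨̇ ¬̇ ψ) (or fφ (neg fψ)) exhaustive ⟩
      1#             ∎
      where
      disjoint : Valid (¬̇ (φ ∧̇ ¬̇ ψ))
      disjoint v _ rewrite φ≋ψ v = Equivalence.from T-not-≡ (∧-inverseʳ (⟦ ψ ⟧ v))
      exhaustive : Valid (φ ∨̇ ¬̇ ψ)
      exhaustive v _ rewrite φ≋ψ v = Equivalence.from T-≡ (∨-inverseʳ (⟦ ψ ⟧ v))

    P-cong : ∀ {φ ψ} → Fm φ → Fm ψ → φ ≋ ψ → P φ ≈ P ψ
    P-cong {φ} {ψ} fφ fψ φ≋ψ = +-cancelʳ (P (¬̇ ψ)) (P φ) (P ψ) (begin
      P φ + P (¬̇ ψ)  ≈⟨ P-complement fφ fψ φ≋ψ ⟩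
      1#             ≈⟨ P-complement fψ fψ (≋-refl {ψ}) ⟨
      P ψ + P (¬̇ ψ)  ∎)

    Pc-cong : ∀ {φ ψ H} → Fm φ → Fm ψ → H ∈ 𝓗 → φ ≋ ψ → Pc φ H ≈ Pc ψ H
    Pc-cong {φ} {ψ} {H} fφ fψ H∈𝓗 φ≋ψ =
      *-congʳ (P-cong (and fφ (Fm-var H∈𝓗)) (and fψ (Fm-var H∈𝓗)) (λ v → cong (_∧ v H) (φ≋ψ v)))

    Pc-additive : ∀ {φ ψ H} → Fm φ → Fm ψ → H ∈ 𝓗 → Valid (¬̇ (φ ∧̇ ψ)) →
                  Pc (φ ∨̇ ψ) H ≈ Pc φ H + Pc ψ H
    Pc-additive {φ} {ψ} {H} fφ fψ H∈𝓗 incompatible = begin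
      P ((φ ∨̇ ψ) ∧̇ var H) ÷ P (var H)
        ≈⟨ *-congʳ (P-cong (and (or fφ fψ) fH) (or fφH fψH) (∧̇-distribʳ-∨̇ φ ψ (var H))) ⟩
      P ((φ ∧̇ var H) ∨̇ (ψ ∧̇ var H)) ÷ P (var H)
        ≈⟨ *-congʳ (additive _ _ fφH fψH (Valid-¬∧-∧̇ʳ {φ} {ψ} (var H) incompatible)) ⟩
      (P (φ ∧̇ var H) + P (ψ ∧̇ var H)) * P (var H) ⁻¹
        ≈⟨ distribʳ (P (var H) ⁻¹) _ _ ⟩
      Pc φ H + Pc ψ H ∎
      where
      fH = Fm-var H∈𝓗
      fφH = and fφ fH
      fψH = and fψ fH

    Pc-¬∧ : ∀ {δ γ H} → Fm δ → Fm γ → H ∈ 𝓗 → (¬̇ γ ∷ ¬̇ δ ∷ []) ⊨⊥ →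
            Pc (¬̇ (δ ∧̇ γ)) H ≈ Pc (¬̇ δ) H + Pc (¬̇ γ) H
    Pc-¬∧ {δ} {γ} {H} fδ fγ H∈𝓗 ¬γ,¬δ⊨⊥ = begin
      Pc (¬̇ (δ ∧̇ γ)) H   ≈⟨ Pc-cong (neg (and fδ fγ)) (or (neg fδ) (neg fγ)) H∈𝓗 (¬̇-deMorgan δ γ) ⟩
      Pc (¬̇ δ ∨̇ ¬̇ γ) H  ≈⟨ Pc-additive (neg fδ) (neg fγ) H∈𝓗 (⊨⊥⇒Valid-¬∧ ¬γ,¬δ⊨⊥) ⟩
      Pc (¬̇ δ) H + Pc (¬̇ γ) H ∎

    r-∷ʳ-cong : ∀ Δ {γ δ} → Fm γ → Fm δ → γ ≋ δ → ∀ H → H ∈ 𝓗 → r (Δ ∷ʳ γ) H ≈ r (Δ ∷ʳ δ) H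
    r-∷ʳ-cong Δ {γ} {δ} fγ fδ γ≋δ H H∈𝓗 = begin
      r (Δ ∷ʳ γ) H          ≈⟨ r-∷ʳ Δ γ H ⟩
      r Δ H + Pc (¬̇ γ) H    ≈⟨ +-congˡ (Pc-cong (neg fγ) (neg fδ) H∈𝓗 (λ v → cong not (γ≋δ v))) ⟩
      r Δ H + Pc (¬̇ δ) H    ≈⟨ r-∷ʳ Δ δ H ⟨
      r (Δ ∷ʳ δ) H          ∎

    r-∷ʳ-∧ : ∀ Δ {δ γ} → Fm δ → Fm γ → (¬̇ γ ∷ ¬̇ δ ∷ []) ⊨⊥ →
             ∀ H → H ∈ 𝓗 → r ((Δ ∷ʳ δ) ∷ʳ γ) H ≈ r (Δ ∷ʳ (δ ∧̇ γ)) H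
    r-∷ʳ-∧ Δ {δ} {γ} fδ fγ ¬γ,¬δ⊨⊥ H H∈𝓗 = begin
      r ((Δ ∷ʳ δ) ∷ʳ γ) H                   ≈⟨ r-∷ʳ (Δ ∷ʳ δ) γ H ⟩
      r (Δ ∷ʳ δ) H + Pc (¬̇ γ) H             ≈⟨ +-congʳ (r-∷ʳ Δ δ H) ⟩
      (r Δ H + Pc (¬̇ δ) H) + Pc (¬̇ γ) H     ≈⟨ +-assoc _ _ _ ⟩
      r Δ H + (Pc (¬̇ δ) H + Pc (¬̇ γ) H)     ≈⟨ +-congˡ (Pc-¬∧ fδ fγ H∈𝓗 ¬γ,¬δ⊨⊥) ⟨
      r Δ H + Pc (¬̇ (δ ∧̇ γ)) H              ≈⟨ r-∷ʳ Δ (δ ∧̇ γ) H ⟨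
      r (Δ ∷ʳ (δ ∧̇ γ)) H                    ∎

    LLE : ∀ Δ γ δ φ → FmD γ → FmD δ → (Δ ∷ʳ γ) |~ φ → Valid (γ ↔̇ δ) → (Δ ∷ʳ δ) |~ φ
    LLE Δ γ δ φ fγ fδ Δ,γ|~φ γ↔δ =
      |~-resp-r (Δ ∷ʳ γ) (Δ ∷ʳ δ) φ
        (r-∷ʳ-cong Δ (FmD⇒Fm fγ) (FmD⇒Fm fδ) (Valid-↔⇒≋ {γ} {δ} γ↔δ)) Δ,γ|~φ

    ANDₗ : ∀ Δ γ δ φ → FmD γ → FmD δ →
           ((Δ ∷ʳ δ) ∷ʳ γ) |~ φ → (¬̇ γ ∷ ¬̇ δ ∷ []) ⊨⊥ → (Δ ∷ʳ (δ ∧̇ γ)) |~ φ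
    ANDₗ Δ γ δ φ fγ fδ Δ,δ,γ|~φ ¬γ,¬δ⊨⊥ =
      |~-resp-r ((Δ ∷ʳ δ) ∷ʳ γ) (Δ ∷ʳ (δ ∧̇ γ)) φ
        (r-∷ʳ-∧ Δ (FmD⇒Fm fδ) (FmD⇒Fm fγ) ¬γ,¬δ⊨⊥) Δ,δ,γ|~φ

    ANDₗ-con : ∀ Δ γ δ φ → FmD γ → FmD δ →
               (Δ ∷ʳ (δ ∧̇ γ)) |~ φ → (¬̇ γ ∷ ¬̇ δ ∷ []) ⊨⊥ → ((Δ ∷ʳ δ) ∷ʳ γ) |~ φ
    ANDₗ-con Δ γ δ φ fγ fδ Δ,δ∧γ|~φ ¬γ,¬δ⊨⊥ =
      |~-resp-r (Δ ∷ʳ (δ ∧̇ γ)) ((Δ ∷ʳ δ) ∷ʳ γ) φ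
        (λ H H∈𝓗 → sym (r-∷ʳ-∧ Δ (FmD⇒Fm fδ) (FmD⇒Fm fγ) ¬γ,¬δ⊨⊥ H H∈𝓗)) Δ,δ∧γ|~φ

proposition5 : ∀ {c ℓ₁ ℓ₂ : Level} (𝔽 : OrderedField c ℓ₁ ℓ₂) (𝓗 𝓓 : List ℕ)
    (P : Form → OrderedField.Carrier 𝔽) →
    Setup.IsProbability 𝔽 𝓗 𝓓 P →
    (∀ H → H ∈ 𝓗 → OrderedField._<_ 𝔽 (OrderedField.0# 𝔽) (P (var H))) →
    let open Setup 𝔽 𝓗 𝓓 in let open lRJ P in
    (∀ Δ φ ψ → All FmD Δ → FmH φ → FmH ψ →
      Δ |~ φ → (φ ∷ []) ⊨ ψ → Δ |~ ψ)
    × (∀ Δ γ δ φ → All FmD Δ → FmD γ → FmD δ → FmH φ →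
      (Δ ∷ʳ γ) |~ φ → Valid (γ ↔̇ δ) → (Δ ∷ʳ δ) |~ φ)
    × (∀ Δ φ ψ → All FmD Δ → FmH φ → FmH ψ →
      Δ |~ φ → Δ |~ ψ → Δ |~ (φ ∧̇ ψ))
    × (∀ Δ γ δ φ → All FmD Δ → FmD γ → FmD δ → FmH φ →
      ((Δ ∷ʳ δ) ∷ʳ γ) |~ φ → (¬̇ γ ∷ ¬̇ δ ∷ []) ⊨⊥ → (Δ ∷ʳ (δ ∧̇ γ)) |~ φ)
    × (∀ Δ γ δ φ → All FmD Δ → FmD γ → FmD δ → FmH φ →
      (Δ ∷ʳ (δ ∧̇ γ)) |~ φ → (¬̇ γ ∷ ¬̇ δ ∷ []) ⊨⊥ → ((Δ ∷ʳ δ) ∷ʳ γ) |~ φ)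
proposition5 𝔽 𝓗 𝓓 P isProbability _ =
    (λ Δ φ ψ _ _ _ → RWE Δ φ ψ)
  , (λ Δ γ δ φ _ fγ fδ _ → LLE isProbability Δ γ δ φ fγ fδ)
  , (λ Δ φ ψ _ _ _ → AND Δ φ ψ)
  , (λ Δ γ δ φ _ fγ fδ _ → ANDₗ isProbability Δ γ δ φ fγ fδ)
  , (λ Δ γ δ φ _ fγ fδ _ → ANDₗ-con isProbability Δ γ δ φ fγ fδ)
  where open Inference 𝔽 𝓗 𝓓 P
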